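{- Let $A=(a_{ij})$ and $B=(b_{ij})$ be $n\times n$ ASMs and let $F(\{A,B\})$ be the smallest face of $ASM_n$ containing $A$ and $B$. If $a_{ij}=1$ and $b_{ij}=-1$, then $(i,j)$ is a vertex of degree 4 in $\mathcal G(F(\{A,B\}))$. If $\mathcal G(F(\{A,B\}))$ has a vertex $(i,j)$ of degree 4, then $a_{ij}b_{ij}=-1$ or $a_{ij}=b_{ij}=0$.
   Context: An $n\times n$ alternating sign matrix (ASM) is a matrix with entries in $\{0,1,-1\}$ whose rows and columns each sum to $1$ and in which the nonzero entries of each row and of each column alternate in sign. $ASM_n\subset\mathbb{R}^{n\times n}$ is the convex hull of all $n\times n$ ASMs; its vertices are exactly the $n\times n$ ASMs. Grid: internal vertices $(i,j)$, $1\le i,j\le n$ (row index $i$ increasing downward), and boundary vertices $(i,0),(i,n+1),(0,j),(n+1,j)$; grid edges join each internal $(i,j)$ to $(i,j\pm1)$ and $(i\pm1,j)$. The simple flow grid $g(A)$ of an ASM $A=(a_{ij})$ orients every grid edge exactly once: the edge between $(i,j)$ and $(i+1,j)$ is directed from $(i,j)$ to $(i+1,j)$ if $\sum_{i'\le i}a_{i'j}=1$ and the opposite way otherwise; the edge between $(i,j)$ and $(i,j+1)$ is directed from $(i,j)$ to $(i,j+1)$ if $\sum_{j'\le j}a_{ij'}=1$ and the opposite way otherwise. For a face $F$, the elementary flow grid $g(F)$ has as arc set the union of the arc sets of $g(A)$ over the vertices $A$ of $F$. A grid edge is doubly directed in $g(F)$ if both orientations occur. The doubly directed graph $\mathcal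 G(F)$ is the undirected graph whose edges are the doubly directed grid edges of $g(F)$ and whose vertices are the grid vertices incident to at least one such edge. -}

module Defs where

open import Data.Nat using (ℕ; zero; suc; _<ᵇ_)
open import Data.Integer using (ℤ; 0ℤ; 1ℤ; -1ℤ; _+_; _*_; -_; _≤_)
open import Data.Fin using (Fin; toℕ) renaming (zero to fzero; suc to fsuc)
open import Data.Fin using (_<_)
open import Data.Bool using (if_then_else_)
open import Data.Sum using (_⊎_)
open import Data.Product using (_×_; ∃-syntax)
open import Relation.Binary.PropositionalEquality using (_≡_)
open import Relation.Nullary using (¬_)

-- Real n×n matrices are represented by their integer entries; rows and
-- columns are 0-based: paper entry a_{ij} is  A (i-1) (j-1).
Mat : ℕ → Set
Mat n = Fin n → Fin n → ℤ

sumFin : ∀ {n} → (Fin n → ℤ) → ℤ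
sumFin {zero}  f = 0ℤ
sumFin {suc n} f = f fzero + sumFin (λ k → f (fsuc k))

rowSum : ∀ {n} → Mat n → Fin n → ℤ
rowSum A r = sumFin (λ c → A r c)

colSum : ∀ {n} → Mat n → Fin n → ℤ
colSum A c = sumFin (λ r → A r c)

Alternates : ∀ {n} → (Fin n → ℤ) → Set
Alternates {n} v = (k l : Fin n) → k < l → ¬ (v k ≡ 0ℤ) → ¬ (v l ≡ 0ℤ)
  → ((m : Fin n) → k < m → m < l → v m ≡ 0ℤ)
  → v k ≡ - v l

record IsASM {n : ℕ} (A : Mat n) : Set where
  field
    entries  : (r c : Fin n) → (A r c ≡ 0ℤ) ⊎ (A r c ≡ 1ℤ) ⊎ (A r c ≡ -1ℤ)
    rowSum1  : (r : Fin n) → rowSum A r ≡ 1ℤ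
    colSum1  : (c : Fin n) → colSum A c ≡ 1ℤ
    rowAlt   : (r : Fin n) → Alternates (λ c → A r c)
    colAlt   : (c : Fin n) → Alternates (λ r → A r c)

dot : ∀ {n} → Mat n → Mat n → ℤ
dot C X = sumFin (λ r → sumFin (λ c → C r c * X r c))

-- Faces of ASM_n are the sets ASM_n ∩ {X : ⟨C,X⟩ = max_{ASM_n} ⟨C,-⟩}
-- (C = 0 gives ASM_n itself); since ASM_n has integer vertices every
-- face is cut out by an integer C.  The smallest face F({A,B}) is the
-- intersection of all faces containing A and B; its vertices are the
-- ASMs V lying in every such face:
InMinFace : ∀ {n} → Mat n → Mat n → Mat n → Set
InMinFace {n} A B V =
  (C : Mat n) → ((W : Mat n) → IsASM W → dot C W ≤ dot C A)
  → dot C A ≡ dot C B → dot C V ≡ dot C A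

VertexOfMinFace : ∀ {n} → Mat n → Mat n → Mat n → Set
VertexOfMinFace A B V = IsASM V × InMinFace A B V

colPartial : ∀ {n} → Mat n → ℕ → Fin n → ℤ
colPartial V i c = sumFin (λ r → if toℕ r <ᵇ i then V r c else 0ℤ)

rowPartial : ∀ {n} → Mat n → Fin n → ℕ → ℤ
rowPartial V r j = sumFin (λ c → if toℕ c <ᵇ j then V r c else 0ℤ)

-- The vertical grid edge between paper vertices (i,j+1) and (i+1,j+1)
-- (i = 0..n, c = j) is directed downward in g(V) iff colPartial V i c = 1.
-- It is doubly directed in g(F({A,B})) iff two vertices of the face orient it
-- differently.
DoublyV : ∀ {n} → Mat n → Mat n → ℕ → Fin n → Set
DoublyV {n} A B i c =
  ∃[ V ] ∃[ W ] (VertexOfMinFace A B V × VertexOfMinFace A B W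
                 × colPartial V i c ≡ 1ℤ × ¬ (colPartial W i c ≡ 1ℤ))

-- horizontal grid edge between paper vertices (r+1,j) and (r+1,j+1), j = 0..n
DoublyH : ∀ {n} → Mat n → Mat n → Fin n → ℕ → Set
DoublyH {n} A B r j =
  ∃[ V ] ∃[ W ] (VertexOfMinFace A B V × VertexOfMinFace A B W
                 × rowPartial V r j ≡ 1ℤ × ¬ (rowPartial W r j ≡ 1ℤ))

-- internal vertex (r+1,c+1) (paper indices) has degree 4 in 𝒢(F({A,B})):
-- all four incident grid edges (up, down, left, right) are doubly directed.
Degree4 : ∀ {n} → Mat n → Mat n → Fin n → Fin n → Set
Degree4 A B r c =
  DoublyV A B (toℕ r) c × DoublyV A B (suc (toℕ r)) c
  × DoublyH A B r (toℕ c) × DoublyH A B r (suc (toℕ c))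

-- Every column and row partial sum of an ASM is 0 or 1, and an entry is the difference of two
-- consecutive partial sums. So if a_ij = 1 and b_ij = -1, then A and B orient each of the four
-- edges at (i,j) oppositely. Conversely, a partial sum s(X) = Σ_{r<i} x_rj is a linear functional
-- taking only the values 0 and 1 on ASMs, so s or -s is maximised at A; if s(A) = s(B) this
-- cuts out a face containing A and B, on which s is constant, and the edge is not doubly
-- directed. A vertex of degree 4 therefore has s(A) ≠ s(B) just above and just below it, which
-- forces a_ij b_ij = -1 or a_ij = b_ij = 0.
module Submission where

open import Defs
open import Data.Nat using (ℕ; zero; suc; _<ᵇ_; z≤n; s≤s; z<s; s<s; s<s⁻¹)
open import Data.Fin using (Fin; toℕ; _<_) renaming (zero to fzero; suc to fsuc)
open import Data.Fin.Properties using (_≟_)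
open import Data.Vec.Functional using (tail)
open import Data.Integer using (ℤ; 0ℤ; 1ℤ; -1ℤ; _+_; _-_; _*_; -_; _≤_; +≤+; -≤+)
open import Data.Integer.Properties
  using (+-0-abelianGroup; +-identityˡ; +-identityʳ; +-inverseʳ; +-assoc; +-comm;
         *-identityˡ; *-zeroˡ; neg-involutive; neg-injective; neg-distrib-+; neg-distribˡ-*)
  renaming (_≟_ to _≟ℤ_)
open import Algebra.Properties.AbelianGroup +-0-abelianGroup using (xyx⁻¹≈y)
open import Data.Bool using (Bool; true; false; if_then_else_)
open import Data.Sum using (_⊎_; inj₁; inj₂; [_,_])
import Data.Sum as Sum
open import Data.Product using (_×_; _,_; proj₁; proj₂; ∃; assocʳ′)
open import Relation.Nullary using (yes; no; does; contradiction)
open import Relation.Binary.PropositionalEquality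
  using (_≡_; _≢_; refl; sym; trans; cong; cong₂; subst; subst₂; module ≡-Reasoning)
open ≡-Reasoning

private
  variable
    n : ℕ
    x p q : ℤ

sumFin-cong : {f g : Fin n → ℤ} → (∀ k → f k ≡ g k) → sumFin f ≡ sumFin g
sumFin-cong {zero}  f≗g = refl
sumFin-cong {suc n} f≗g = cong₂ _+_ (f≗g fzero) (sumFin-cong (λ k → f≗g (fsuc k)))

sumFin-zero : sumFin {n} (λ _ → 0ℤ) ≡ 0ℤ
sumFin-zero {zero}  = refl
sumFin-zero {suc n} = trans (+-identityˡ _) (sumFin-zero {n})

sumFin-neg : (f : Fin n → ℤ) → sumFin (λ k → - f k) ≡ - sumFin f
sumFin-neg {zero}  f = refl
sumFin-neg {suc n} f = begin
  - f fzero + sumFin (λ k → - f (fsuc k)) ≡⟨ cong (- f fzero +_) (sumFin-neg (tail f)) ⟩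
  - f fzero + - sumFin (tail f)           ≡⟨ neg-distrib-+ (f fzero) _ ⟨
  - sumFin f                              ∎

prefixSum : (Fin n → ℤ) → ℕ → ℤ
prefixSum v i = sumFin (λ k → if toℕ k <ᵇ i then v k else 0ℤ)

prefixSum-zero : (v : Fin n → ℤ) → prefixSum v 0 ≡ 0ℤ
prefixSum-zero {n} v = sumFin-zero {n}

prefixSum-total : (v : Fin n → ℤ) → prefixSum v n ≡ sumFin v
prefixSum-total {zero}  v = refl
prefixSum-total {suc n} v = cong (v fzero +_) (prefixSum-total (tail v))

prefixSum-step : (v : Fin n → ℤ) (k : Fin n) →
                 prefixSum v (suc (toℕ k)) ≡ prefixSum v (toℕ k) + v k
prefixSum-step v fzero = begin
  v fzero + prefixSum (tail v) 0 ≡⟨ cong (v fzero +_) (prefixSum-zero (tail v)) ⟩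
  v fzero + 0ℤ                   ≡⟨ +-comm (v fzero) 0ℤ ⟩
  0ℤ + v fzero                   ≡⟨ cong (_+ v fzero) (prefixSum-zero v) ⟨
  prefixSum v 0 + v fzero        ∎
prefixSum-step v (fsuc k) = begin
  v fzero + prefixSum (tail v) (suc (toℕ k))
    ≡⟨ cong (v fzero +_) (prefixSum-step (tail v) k) ⟩
  v fzero + (prefixSum (tail v) (toℕ k) + v (fsuc k))
    ≡⟨ +-assoc (v fzero) _ (v (fsuc k)) ⟨
  prefixSum v (suc (toℕ k)) + v (fsuc k)
    ∎

prefixSum-difference : (v : Fin n → ℤ) (k : Fin n) →
                       prefixSum v (suc (toℕ k)) - prefixSum v (toℕ k) ≡ v k
prefixSum-difference v k = trans (cong (_- prefixSum v (toℕ k)) (prefixSum-step v k))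
                                  (xyx⁻¹≈y (prefixSum v (toℕ k)) (v k))

IsBit : ℤ → Set
IsBit x = x ≡ 0ℤ ⊎ x ≡ 1ℤ

-- x is the first nonzero entry of v; every x qualifies when v is zero.
Leading : ℤ → (Fin n → ℤ) → Set
Leading {n} x v = (k : Fin n) → v k ≢ 0ℤ → ((m : Fin n) → m < k → v m ≡ 0ℤ) → v k ≡ x

∃-leading : (v : Fin n → ℤ) → ∃ λ x → Leading x v
∃-leading {zero}  v = 0ℤ , λ ()
∃-leading {suc n} v with v fzero ≟ℤ 0ℤ
... | no  v₀≢0 = v fzero , λ where
  fzero    _ _      → refl
  (fsuc k) _ before → contradiction (before fzero z<s) v₀≢0
... | yes v₀≡0 with ∃-leading (tail v)
...   | x , lead = x , λ where
  fzero    vk≢0 _      → contradiction v₀≡0 vk≢0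
  (fsuc k) vk≢0 before → lead k vk≢0 (λ m m<k → before (fsuc m) (s<s m<k))

alternates-tail : {v : Fin (suc n) → ℤ} → Alternates v → Alternates (tail v)
alternates-tail alt k l k<l vk≢0 vl≢0 between =
  alt (fsuc k) (fsuc l) (s<s k<l) vk≢0 vl≢0 λ where
    (fsuc m) k<m m<l → between m (s<s⁻¹ k<m) (s<s⁻¹ m<l)

leading-tail : {v : Fin (suc n) → ℤ} → v fzero ≡ 0ℤ → Leading x v → Leading x (tail v)
leading-tail v₀≡0 lead k vk≢0 before = lead (fsuc k) vk≢0 λ where
  fzero    _   → v₀≡0
  (fsuc m) m<k → before m (s<s⁻¹ m<k)

leading-tail-alternating : {v : Fin (suc n) → ℤ} → Alternates v → v fzero ≢ 0ℤ →
                           Leading (- v fzero) (tail v)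
leading-tail-alternating {v = v} alt v₀≢0 k vk≢0 before = begin
  v (fsuc k)     ≡⟨ neg-involutive (v (fsuc k)) ⟨
  - - v (fsuc k) ≡⟨ cong -_ v₀≡-vk ⟨
  - v fzero      ∎
  where
  v₀≡-vk : v fzero ≡ - v (fsuc k)
  v₀≡-vk = alt fzero (fsuc k) z<s v₀≢0 vk≢0 λ where
    (fsuc m) _ m<k → before m (s<s⁻¹ m<k)

-- Peeling off a nonzero first entry x leaves a sequence led by -x, so the partial sums
-- keep alternating between 0 and x.
prefixSum-alternating : {v : Fin n → ℤ} → Alternates v → Leading x v →
                        ∀ i → prefixSum v i ≡ 0ℤ ⊎ prefixSum v i ≡ x
prefixSum-alternating {zero}          _   _    _       = inj₁ refl
prefixSum-alternating {suc n} {v = v} _   _    zero    = inj₁ (prefixSum-zero v)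
prefixSum-alternating {suc n} {x = x} {v = v} alt lead (suc i) with v fzero ≟ℤ 0ℤ
... | yes v₀≡0 = Sum.map (trans drop-v₀) (trans drop-v₀)
                   (prefixSum-alternating (alternates-tail alt) (leading-tail v₀≡0 lead) i)
  where
  drop-v₀ : prefixSum v (suc i) ≡ prefixSum (tail v) i
  drop-v₀ = trans (cong (_+ prefixSum (tail v) i) v₀≡0) (+-identityˡ _)
... | no v₀≢0 = [ (λ s≡0   → inj₂ (trans (cong (v fzero +_) s≡0) (trans (+-identityʳ _) v₀≡x)))
                , (λ s≡-v₀ → inj₁ (trans (cong (v fzero +_) s≡-v₀) (+-inverseʳ (v fzero)))) ]
                (prefixSum-alternating (alternates-tail alt) (leading-tail-alternating alt v₀≢0) i)
  where
  v₀≡x : v fzero ≡ x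
  v₀≡x = lead fzero v₀≢0 λ _ ()

prefixSum-isBit : {v : Fin n → ℤ} → Alternates v → sumFin v ≡ 1ℤ →
                  ∀ i → IsBit (prefixSum v i)
prefixSum-isBit {n} {v} alt total i with ∃-leading v
... | x , lead = Sum.map₂ (λ s≡x → trans s≡x x≡1) (prefixSum-alternating alt lead i)
  where
  total′ : prefixSum v n ≡ 1ℤ
  total′ = trans (prefixSum-total v) total
  x≡1 : x ≡ 1ℤ
  x≡1 = [ (λ s≡0 → contradiction (trans (sym s≡0) total′) λ ())
        , (λ s≡x → trans (sym s≡x) total′) ]
        (prefixSum-alternating alt lead n)

isBit⇒≤1 : IsBit x → x ≤ 1ℤ
isBit⇒≤1 (inj₁ refl) = +≤+ z≤n
isBit⇒≤1 (inj₂ refl) = +≤+ (s≤s z≤n)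

isBit⇒-≤0 : IsBit x → - x ≤ 0ℤ
isBit⇒-≤0 (inj₁ refl) = +≤+ z≤n
isBit⇒-≤0 (inj₂ refl) = -≤+

isBit-rise : IsBit p → IsBit q → q - p ≡ 1ℤ → p ≡ 0ℤ × q ≡ 1ℤ
isBit-rise (inj₁ refl) (inj₂ refl) _  = refl , refl
isBit-rise (inj₁ refl) (inj₁ refl) ()
isBit-rise (inj₂ refl) (inj₁ refl) ()
isBit-rise (inj₂ refl) (inj₂ refl) ()

isBit-fall : IsBit p → IsBit q → q - p ≡ -1ℤ → p ≡ 1ℤ × q ≡ 0ℤ
isBit-fall (inj₂ refl) (inj₁ refl) _  = refl , refl
isBit-fall (inj₁ refl) (inj₁ refl) ()
isBit-fall (inj₁ refl) (inj₂ refl) ()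
isBit-fall (inj₂ refl) (inj₂ refl) ()

isBit-differences : ∀ {p p′ q q′ a a′} → IsBit p → IsBit p′ → IsBit q → IsBit q′ →
                    p ≢ p′ → q ≢ q′ → q - p ≡ a → q′ - p′ ≡ a′ →
                    a * a′ ≡ -1ℤ ⊎ (a ≡ 0ℤ × a′ ≡ 0ℤ)
isBit-differences (inj₁ refl) (inj₁ refl) _           _           p≢p′ _    = contradiction refl p≢p′
isBit-differences (inj₂ refl) (inj₂ refl) _           _           p≢p′ _    = contradiction refl p≢p′
isBit-differences _           _           (inj₁ refl) (inj₁ refl) _    q≢q′ = contradiction refl q≢q′
isBit-differences _           _           (inj₂ refl) (inj₂ refl) _    q≢q′ = contradiction refl q≢q′
isBit-differences (inj₁ refl) (inj₂ refl) (inj₁ refl) (inj₂ refl) _ _ refl refl = inj₂ (refl , refl)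
isBit-differences (inj₁ refl) (inj₂ refl) (inj₂ refl) (inj₁ refl) _ _ refl refl = inj₁ refl
isBit-differences (inj₂ refl) (inj₁ refl) (inj₁ refl) (inj₂ refl) _ _ refl refl = inj₁ refl
isBit-differences (inj₂ refl) (inj₁ refl) (inj₂ refl) (inj₁ refl) _ _ refl refl = inj₂ (refl , refl)

prefixSum-around-one : {v : Fin n → ℤ} → (∀ i → IsBit (prefixSum v i)) →
                       (k : Fin n) → v k ≡ 1ℤ →
                       prefixSum v (toℕ k) ≡ 0ℤ × prefixSum v (suc (toℕ k)) ≡ 1ℤ
prefixSum-around-one {v = v} bit k vk≡1 =
  isBit-rise (bit (toℕ k)) (bit (suc (toℕ k))) (trans (prefixSum-difference v k) vk≡1)

prefixSum-around-minusOne : {v : Fin n → ℤ} → (∀ i → IsBit (prefixSum v i)) →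
                            (k : Fin n) → v k ≡ -1ℤ →
                            prefixSum v (toℕ k) ≡ 1ℤ × prefixSum v (suc (toℕ k)) ≡ 0ℤ
prefixSum-around-minusOne {v = v} bit k vk≡-1 =
  isBit-fall (bit (toℕ k)) (bit (suc (toℕ k))) (trans (prefixSum-difference v k) vk≡-1)

colPartial-isBit : {X : Mat n} → IsASM X → ∀ c i → IsBit (colPartial X i c)
colPartial-isBit asm c i = prefixSum-isBit (IsASM.colAlt asm c) (IsASM.colSum1 asm c) i

rowPartial-isBit : {X : Mat n} → IsASM X → ∀ r j → IsBit (rowPartial X r j)
rowPartial-isBit asm r j = prefixSum-isBit (IsASM.rowAlt asm r) (IsASM.rowSum1 asm r) j

δ : Fin n → Fin n → ℤ
δ c c′ = if does (c ≟ c′) then 1ℤ else 0ℤ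

sumFin-δ : (c : Fin n) (g : Fin n → ℤ) → sumFin (λ c′ → δ c c′ * g c′) ≡ g c
sumFin-δ {suc n} fzero g =
  trans (cong₂ _+_ (*-identityˡ (g fzero)) zeros) (+-identityʳ (g fzero))
  where
  zeros : sumFin (λ c′ → 0ℤ * g (fsuc c′)) ≡ 0ℤ
  zeros = trans (sumFin-cong (λ c′ → *-zeroˡ (g (fsuc c′)))) (sumFin-zero {n})
sumFin-δ {suc n} (fsuc c) g = trans (+-identityˡ _) (sumFin-δ c (tail g))

negate : Mat n → Mat n
negate C r c = - C r c

dot-negate : (C X : Mat n) → dot (negate C) X ≡ - dot C X
dot-negate C X = trans (sumFin-cong row) (sumFin-neg (λ r → sumFin (λ c → C r c * X r c)))
  where
  row : ∀ r → sumFin (λ c → - C r c * X r c) ≡ - sumFin (λ c → C r c * X r c)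
  row r = trans (sumFin-cong (λ c → sym (neg-distribˡ-* (C r c) (X r c))))
                (sumFin-neg (λ c → C r c * X r c))

columnPrefix : ℕ → Fin n → Mat n
columnPrefix i c r c′ = if toℕ r <ᵇ i then δ c c′ else 0ℤ

dot-columnPrefix : (i : ℕ) (c : Fin n) (X : Mat n) → dot (columnPrefix i c) X ≡ colPartial X i c
dot-columnPrefix {n} i c X = sumFin-cong (λ r → row (toℕ r <ᵇ i) (X r))
  where
  row : (b : Bool) (g : Fin n → ℤ) →
        sumFin (λ c′ → (if b then δ c c′ else 0ℤ) * g c′) ≡ (if b then g c else 0ℤ)
  row true  g = sumFin-δ c g
  row false g = trans (sumFin-cong (λ c′ → *-zeroˡ (g c′))) (sumFin-zero {n})

-- If ⟨C,A⟩ = 1 then C is maximised at A, and if ⟨C,A⟩ = 0 then -C is; either way the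
-- face it cuts out contains A and B.
bitValued-constantOnMinFace : {A B V : Mat n} (C : Mat n) → (∀ X → IsASM X → IsBit (dot C X)) →
                              IsASM A → dot C A ≡ dot C B → InMinFace A B V → dot C V ≡ dot C A
bitValued-constantOnMinFace {A = A} {B} {V} C bit asmA CA≡CB V∈F with bit A asmA
... | inj₂ CA≡1 = V∈F C (λ X asmX → subst (dot C X ≤_) (sym CA≡1) (isBit⇒≤1 (bit X asmX))) CA≡CB
... | inj₁ CA≡0 = neg-injective (begin
  - dot C V          ≡⟨ dot-negate C V ⟨
  dot (negate C) V   ≡⟨ V∈F (negate C) maximal (trans (dot-negate C A)
                          (trans (cong -_ CA≡CB) (sym (dot-negate C B)))) ⟩
  dot (negate C) A   ≡⟨ dot-negate C A ⟩
  - dot C A          ∎)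
  where
  maximal : ∀ X → IsASM X → dot (negate C) X ≤ dot (negate C) A
  maximal X asmX = subst₂ _≤_ (sym (dot-negate C X))
                            (trans (cong -_ (sym CA≡0)) (sym (dot-negate C A)))
                            (isBit⇒-≤0 (bit X asmX))

colPartial-constantOnMinFace : {A B V : Mat n} → IsASM A → IsASM B → ∀ i c →
                               colPartial A i c ≡ colPartial B i c → InMinFace A B V →
                               colPartial V i c ≡ colPartial A i c
colPartial-constantOnMinFace {n} {A} {B} {V} asmA asmB i c pA≡pB V∈F = begin
  colPartial V i c ≡⟨ dot-columnPrefix i c V ⟨
  dot C V          ≡⟨ bitValued-constantOnMinFace C bit asmA CA≡CB V∈F ⟩
  dot C A          ≡⟨ dot-columnPrefix i c A ⟩
  colPartial A i c ∎
  where
  C : Mat n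
  C = columnPrefix i c
  bit : ∀ X → IsASM X → IsBit (dot C X)
  bit X asmX = subst IsBit (sym (dot-columnPrefix i c X)) (colPartial-isBit asmX c i)
  CA≡CB : dot C A ≡ dot C B
  CA≡CB = trans (dot-columnPrefix i c A) (trans pA≡pB (sym (dot-columnPrefix i c B)))

doublyV⇒colPartial-≢ : {A B : Mat n} → IsASM A → IsASM B → ∀ i c → DoublyV A B i c →
                       colPartial A i c ≢ colPartial B i c
doublyV⇒colPartial-≢ {A = A} {B} asmA asmB i c (_ , _ , (_ , V∈F) , (_ , W∈F) , pV≡1 , pW≢1) pA≡pB =
  pW≢1 (trans (constant W∈F) (trans (sym (constant V∈F)) pV≡1))
  where
  constant : ∀ {X} → InMinFace A B X → colPartial X i c ≡ colPartial A i c
  constant = colPartial-constantOnMinFace asmA asmB i c pA≡pB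

vertexOfMinFaceˡ : {A B : Mat n} → IsASM A → VertexOfMinFace A B A
vertexOfMinFaceˡ asmA = asmA , λ _ _ _ → refl

vertexOfMinFaceʳ : {A B : Mat n} → IsASM B → VertexOfMinFace A B B
vertexOfMinFaceʳ asmB = asmB , λ _ _ CA≡CB → sym CA≡CB

separated : ∀ {x y} → x ≡ 1ℤ → y ≡ 0ℤ → x ≡ 1ℤ × y ≢ 1ℤ
separated x≡1 y≡0 = x≡1 , λ y≡1 → contradiction (trans (sym y≡0) y≡1) λ ()

opposite⇒doublyV : {A B : Mat n} → IsASM A → IsASM B → ∀ r c → A r c ≡ 1ℤ → B r c ≡ -1ℤ →
                   DoublyV A B (toℕ r) c × DoublyV A B (suc (toℕ r)) c
opposite⇒doublyV {A = A} {B} asmA asmB r c a≡1 b≡-1 =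
  (B , A , vertexOfMinFaceʳ asmB , vertexOfMinFaceˡ asmA , separated (proj₁ colB) (proj₁ colA)) ,
  (A , B , vertexOfMinFaceˡ asmA , vertexOfMinFaceʳ asmB , separated (proj₂ colA) (proj₂ colB))
  where
  colA : colPartial A (toℕ r) c ≡ 0ℤ × colPartial A (suc (toℕ r)) c ≡ 1ℤ
  colA = prefixSum-around-one (colPartial-isBit asmA c) r a≡1
  colB : colPartial B (toℕ r) c ≡ 1ℤ × colPartial B (suc (toℕ r)) c ≡ 0ℤ
  colB = prefixSum-around-minusOne (colPartial-isBit asmB c) r b≡-1

opposite⇒doublyH : {A B : Mat n} → IsASM A → IsASM B → ∀ r c → A r c ≡ 1ℤ → B r c ≡ -1ℤ →
                   DoublyH A B r (toℕ c) × DoublyH A B r (suc (toℕ c))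
opposite⇒doublyH {A = A} {B} asmA asmB r c a≡1 b≡-1 =
  (B , A , vertexOfMinFaceʳ asmB , vertexOfMinFaceˡ asmA , separated (proj₁ rowB) (proj₁ rowA)) ,
  (A , B , vertexOfMinFaceˡ asmA , vertexOfMinFaceʳ asmB , separated (proj₂ rowA) (proj₂ rowB))
  where
  rowA : rowPartial A r (toℕ c) ≡ 0ℤ × rowPartial A r (suc (toℕ c)) ≡ 1ℤ
  rowA = prefixSum-around-one (rowPartial-isBit asmA r) c a≡1
  rowB : rowPartial B r (toℕ c) ≡ 1ℤ × rowPartial B r (suc (toℕ c)) ≡ 0ℤ
  rowB = prefixSum-around-minusOne (rowPartial-isBit asmB r) c b≡-1

doublyV-around⇒entries : {A B : Mat n} → IsASM A → IsASM B → ∀ r c →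
                         DoublyV A B (toℕ r) c → DoublyV A B (suc (toℕ r)) c →
                         A r c * B r c ≡ -1ℤ ⊎ (A r c ≡ 0ℤ × B r c ≡ 0ℤ)
doublyV-around⇒entries {A = A} {B} asmA asmB r c above below =
  isBit-differences (colPartial-isBit asmA c (toℕ r)) (colPartial-isBit asmB c (toℕ r))
                    (colPartial-isBit asmA c (suc (toℕ r))) (colPartial-isBit asmB c (suc (toℕ r)))
                    (doublyV⇒colPartial-≢ asmA asmB (toℕ r) c above)
                    (doublyV⇒colPartial-≢ asmA asmB (suc (toℕ r)) c below)
                    (prefixSum-difference (λ r′ → A r′ c) r)
                    (prefixSum-difference (λ r′ → B r′ c) r)

mainTheorem19 : (n : ℕ) (A B : Mat n) → IsASM A → IsASM B → (r c : Fin n) →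
    ((A r c ≡ 1ℤ → B r c ≡ -1ℤ → Degree4 A B r c)
     × (Degree4 A B r c → (A r c * B r c ≡ -1ℤ) ⊎ (A r c ≡ 0ℤ × B r c ≡ 0ℤ)))
mainTheorem19 n A B asmA asmB r c =
  (λ a≡1 b≡-1 → assocʳ′ ( opposite⇒doublyV asmA asmB r c a≡1 b≡-1
                        , opposite⇒doublyH asmA asmB r c a≡1 b≡-1)) ,
  (λ (above , below , _) → doublyV-around⇒entries asmA asmB r c above below)
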